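{- Let $K$ be an H-field with composition and inversion over $\mathbb{R}$. Let $f,g\in K^{>\mathbb{R}}$ with $f,g>x$, such that $f>x+r$ for all $r\in\mathbb{R}$, and $g=x+1+\varepsilon$ for some $\varepsilon\in\mathcal{o}$ with $\varepsilon>0$. Then $f\circ g>g\circ f$.
   Context: An H-field is an ordered field $K$ with a convex valuation ring $\mathcal{O}$ (maximal ideal $\mathcal{o}$) and a derivation $a\mapsto a'$ such that (HF1) every $a\in\mathcal{O}$ has $c\in C:=\mathrm{Ker}(\partial)$ with $a-c\in\mathcal{o}$, and (HF2) $a>C$ implies $a'>0$; "over $\mathbb{R}$" means $C=\mathbb{R}$. Notation: $K^{>C}=\{a: a>C\}$, $\mathcal{o}(a)=\mathcal{o}a$, $a^{\dagger}=a'/a$, $a^{(k)}$ the $k$-th derivative. An H-field with composition is an H-field with $x\in K^{>C}$, $x'=1$, and $\circ: K\times K^{>C}\to K$ satisfying: (HFC1) for each $b\in K^{>C}$, $a\mapsto a\circ b$ is a $C$-linear morphism of ordered rings; (HFC2) $a\circ(b\circ d)=(a\circ b)\circ d$; (HFC3) for $a\in K^{>C}$, $b\mapsto a\circ b$ is strictly increasing $K^{>C}\to K^{>C}$; (HFC4) $a\circ x=a$, $x\circ b=b$; (HFC5) for $a,\delta\in K$, $b\in K^{>C}$ with $\delta\in\mathcal{o}(a)$ and $(a^{\dagger}\circ b)\delta\in\mathcal{o}$, for all $n\in\mathbb{N}$: $a\circ(b+\delta)-\sum_{k\leqslant n}\frac{a^{(k)}\circ b}{k!}\delta^k\in\mathcal{o}((a^{(n)}\circ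 b)\delta^n)$. It has inversion if $(K^{>C},\circ,x)$ is a group. -}

module Defs where

open import Level using (Level; suc; _⊔_)
open import Data.Nat using (ℕ; zero) renaming (suc to 1+)
open import Data.Nat.Base using (_!)
open import Data.Product using (Σ; ∃; _×_; _,_)
open import Data.Sum using (_⊎_)
open import Relation.Nullary using (¬_)
open import Relation.Binary.PropositionalEquality using (_≡_)
open import Relation.Binary.Structures using (IsStrictTotalOrder)
open import Algebra.Structures using (IsCommutativeRing)

-- Ordered fields (equality is propositional equality on an abstract
-- carrier; the multiplicative inverse is total with 0⁻¹ = 0, the usual
-- convention for a total inverse function).

record OrderedField (ℓ : Level) : Set (suc ℓ) where
  infixl 6 _+_
  infixl 7 _*_
  infix  4 _<_
  field
    Carrier : Set ℓ
    _+_ _*_ : Carrier → Carrier → Carrier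
    -_      : Carrier → Carrier
    0# 1#   : Carrier
    _⁻¹     : Carrier → Carrier
    _<_     : Carrier → Carrier → Set ℓ
    isCommutativeRing : IsCommutativeRing _≡_ _+_ _*_ -_ 0# 1#
    0≢1     : ¬ (0# ≡ 1#)
    ⁻¹-inverse : ∀ a → ¬ (a ≡ 0#) → a * (a ⁻¹) ≡ 1#
    0⁻¹     : 0# ⁻¹ ≡ 0#
    isStrictTotalOrder : IsStrictTotalOrder _≡_ _<_
    +-mono-< : ∀ a b c → a < b → a + c < b + c
    *-pos    : ∀ a b → 0# < a → 0# < b → 0# < a * b

module OF {ℓ : Level} (F : OrderedField ℓ) where
  open OrderedField F public
  K = Carrier

  infixl 6 _-_
  _-_ : K → K → K
  a - b = a + (- b)

  infix 4 _≤_
  _≤_ : K → K → Set ℓ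
  a ≤ b = (a < b) ⊎ (a ≡ b)

  fromℕ : ℕ → K
  fromℕ zero = 0#
  fromℕ (1+ n) = 1# + fromℕ n

  pow : K → ℕ → K
  pow a zero = 1#
  pow a (1+ n) = a * pow a n

  iter : (K → K) → ℕ → K → K
  iter d zero a = a
  iter d (1+ n) a = d (iter d n a)

  sumTo : ℕ → (ℕ → K) → K
  sumTo zero t = t zero
  sumTo (1+ n) t = sumTo n t + t (1+ n)

  -- the maximal ideal of a valuation ring O: the non-units of O
  small : (K → Set ℓ) → K → Set ℓ
  small O a = O a × (∀ b → O b → ¬ (a * b ≡ 1#))

  smallOf : (K → Set ℓ) → K → K → Set ℓ
  smallOf O a δ = Σ K (λ e → small O e × (δ ≡ e * a))

  Const : (K → K) → K → Set ℓ
  Const d c = d c ≡ 0#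

  AboveC : (K → K) → K → Set ℓ
  AboveC d a = ∀ c → Const d c → c < a

-- H-fields with composition and inversion over ℝ.
-- The composition is a total operation K → K → K of which only the
-- restriction to K × K^{>C} is constrained by the axioms.

record HFieldCompInvOverℝ {ℓ : Level} (F : OrderedField ℓ) : Set (suc ℓ) where
  open OF F
  field
    O        : K → Set ℓ
    O-0      : O 0#
    O-1      : O 1#
    O-+      : ∀ a b → O a → O b → O (a + b)
    O-neg    : ∀ a → O a → O (- a)
    O-*      : ∀ a b → O a → O b → O (a * b)
    O-val    : ∀ a → ¬ (a ≡ 0#) → O a ⊎ O (a ⁻¹)
    O-convex : ∀ a b c → O a → O c → a ≤ b → b ≤ c → O b
    ∂        : K → K
    ∂-+      : ∀ a b → ∂ (a + b) ≡ ∂ a + ∂ b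
    ∂-*      : ∀ a b → ∂ (a * b) ≡ ∂ a * b + a * ∂ b
    HF1      : ∀ a → O a → Σ K (λ c → Const ∂ c × small O (a - c))
    HF2      : ∀ a → AboveC ∂ a → 0# < ∂ a
    -- over ℝ: the constant field C is a Dedekind-complete ordered field
    -- (hence C ≅ ℝ): every inhabited subset of C bounded above in C has a
    -- least upper bound in C.
    C-complete : (S : K → Set ℓ) → (∀ s → S s → Const ∂ s) → Σ K S →
                 Σ K (λ u → Const ∂ u × (∀ s → S s → s ≤ u)) →
                 Σ K (λ u → Const ∂ u × (∀ s → S s → s ≤ u)
                        × (∀ v → Const ∂ v → (∀ s → S s → s ≤ v) → u ≤ v))
    x        : K
    x-above  : AboveC ∂ x
    ∂x       : ∂ x ≡ 1#
    _∘_      : K → K → K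
    HFC1-+   : ∀ a a' b → AboveC ∂ b → (a + a') ∘ b ≡ (a ∘ b) + (a' ∘ b)
    HFC1-*   : ∀ a a' b → AboveC ∂ b → (a * a') ∘ b ≡ (a ∘ b) * (a' ∘ b)
    HFC1-1   : ∀ b → AboveC ∂ b → 1# ∘ b ≡ 1#
    HFC1-lin : ∀ c a b → Const ∂ c → AboveC ∂ b → (c * a) ∘ b ≡ c * (a ∘ b)
    HFC1-≤   : ∀ a b → AboveC ∂ b → 0# ≤ a → 0# ≤ a ∘ b
    HFC2     : ∀ a b e → AboveC ∂ b → AboveC ∂ e → a ∘ (b ∘ e) ≡ (a ∘ b) ∘ e
    HFC3-above : ∀ a b → AboveC ∂ a → AboveC ∂ b → AboveC ∂ (a ∘ b)
    HFC3-mono  : ∀ a b e → AboveC ∂ a → AboveC ∂ b → AboveC ∂ e →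
                 b < e → a ∘ b < a ∘ e
    HFC4-r   : ∀ a → a ∘ x ≡ a
    HFC4-l   : ∀ b → AboveC ∂ b → x ∘ b ≡ b
    HFC5     : ∀ a δ b → AboveC ∂ b → AboveC ∂ (b + δ) →
               smallOf O a δ → small O (((∂ a * (a ⁻¹)) ∘ b) * δ) →
               ∀ n → smallOf O ((iter ∂ n a ∘ b) * pow δ n)
                       (a ∘ (b + δ) -
                        sumTo n (λ k → ((iter ∂ k a ∘ b) * (fromℕ (k !) ⁻¹))
                                         * pow δ k))
    inversion : ∀ b → AboveC ∂ b →
                Σ K (λ b⁻ → AboveC ∂ b⁻ × (b ∘ b⁻ ≡ x) × (b⁻ ∘ b ≡ x))

-- Composition on the right is additive and fixes x and 1, so with g = x + 1 + ε
-- we get g ∘ f = f + 1 + ε ∘ f and f ∘ g = (f - x) ∘ g + g.  Right composition with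
-- an element above x increases every element above C.  This applies to f - x, and
-- to ε⁻¹, which lies above C because ε is a positive infinitesimal and C ⊆ O by the
-- completeness of C.  So (f - x) ∘ g > f - x and ε ∘ f = (ε⁻¹ ∘ f)⁻¹ < ε, hence
-- g ∘ f < f + 1 + ε = (f - x) + g < f ∘ g.

{-# OPTIONS --safe #-}
module Submission where

open import Defs
open import Level using (Level)
open import Data.Empty using (⊥-elim)
open import Data.Product using (Σ; _×_; _,_; proj₁)
open import Data.Sum using (inj₁; inj₂)
open import Relation.Nullary using (¬_)
open import Relation.Binary.PropositionalEquality
  using (_≡_; refl; sym; trans; cong; cong₂; subst; subst₂; module ≡-Reasoning)
open import Relation.Binary.Definitions using (tri<; tri≈; tri>)
open import Relation.Binary.Structures using (IsStrictTotalOrder)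
open import Relation.Binary.Bundles using (StrictPartialOrder)
import Relation.Binary.Construct.StrictToNonStrict as NonStrict
import Relation.Binary.Reasoning.StrictPartialOrder as StrictReasoning
open import Algebra.Structures using (IsCommutativeRing)
open import Algebra.Bundles using (Ring)
import Algebra.Properties.Ring as RingProperties

module OrderedFieldProperties {ℓ : Level} (F : OrderedField ℓ) where
  open OF F
  open IsCommutativeRing isCommutativeRing public
    using (+-assoc; +-comm; +-identityˡ; +-identityʳ; -‿inverseʳ; *-identityʳ; *-assoc; *-comm; zeroʳ)
  open IsStrictTotalOrder isStrictTotalOrder public
    using (compare; irrefl; asym; isStrictPartialOrder) renaming (trans to <-trans)

  ring : Ring ℓ ℓ
  ring = record { isRing = IsCommutativeRing.isRing isCommutativeRing }

  open RingProperties ring public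
    using (-0#≈0#; -‿involutive; -‿distribʳ-*; -1*x≈-x; x+x≈x⇒x≈0; x[y-z]≈xy-xz;
           \\-leftDividesˡ; //-rightDividesˡ; //-rightDividesʳ; xyx⁻¹≈y)
  open ≡-Reasoning

  <-strictPartialOrder : StrictPartialOrder ℓ ℓ ℓ
  <-strictPartialOrder = record { isStrictPartialOrder = isStrictPartialOrder }

  <-≤-trans : ∀ {a b c} → a < b → b ≤ c → a < c
  <-≤-trans = NonStrict.<-≤-trans _≡_ _<_ <-trans (λ { refl a<b → a<b })

  ≮⇒≥ : ∀ {a b} → ¬ (b < a) → a ≤ b
  ≮⇒≥ {a} {b} b≮a with compare a b
  ... | tri< a<b _ _ = inj₁ a<b
  ... | tri≈ _ a≡b _ = inj₂ a≡b
  ... | tri> _ _ b<a = ⊥-elim (b≮a b<a)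

  ≰⇒> : ∀ {a b} → ¬ (a ≤ b) → b < a
  ≰⇒> {a} {b} a≰b with compare a b
  ... | tri< a<b _ _ = ⊥-elim (a≰b (inj₁ a<b))
  ... | tri≈ _ a≡b _ = ⊥-elim (a≰b (inj₂ a≡b))
  ... | tri> _ _ b<a = b<a

  +-monoˡ-< : ∀ c {a b} → a < b → a + c < b + c
  +-monoˡ-< c {a} {b} = +-mono-< a b c

  +-monoʳ-< : ∀ c {a b} → a < b → c + a < c + b
  +-monoʳ-< c {a} {b} a<b = subst₂ _<_ (+-comm a c) (+-comm b c) (+-monoˡ-< c a<b)

  +-monoˡ-≤ : ∀ c {a b} → a ≤ b → a + c ≤ b + c
  +-monoˡ-≤ c (inj₁ a<b) = inj₁ (+-monoˡ-< c a<b)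
  +-monoˡ-≤ c (inj₂ refl) = inj₂ refl

  -‿antimono-< : ∀ {a b} → a < b → - b < - a
  -‿antimono-< {a} {b} a<b =
    subst₂ _<_ (\\-leftDividesˡ a (- b)) b+[-a-b]≡-a (+-monoˡ-< (- a - b) a<b)
    where
    b+[-a-b]≡-a : b + (- a - b) ≡ - a
    b+[-a-b]≡-a = trans (cong (b +_) (+-comm (- a) (- b))) (\\-leftDividesˡ b (- a))

  <0⇒0<- : ∀ {a} → a < 0# → 0# < - a
  <0⇒0<- a<0 = subst (_< _) -0#≈0# (-‿antimono-< a<0)

  0<-⇒<0 : ∀ {a} → 0# < - a → a < 0#
  0<-⇒<0 {a} 0<-a = subst₂ _<_ (-‿involutive a) -0#≈0# (-‿antimono-< 0<-a)

  0<1 : 0# < 1#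
  0<1 with compare 0# 1#
  ... | tri< 0<1 _ _ = 0<1
  ... | tri≈ _ 0≡1 _ = ⊥-elim (0≢1 0≡1)
  ... | tri> _ _ 1<0 = ⊥-elim (asym 1<0 (subst (0# <_) [-1][-1]≡1 (*-pos _ _ 0<-1 0<-1)))
    where
    0<-1 : 0# < - 1#
    0<-1 = <0⇒0<- 1<0
    [-1][-1]≡1 : - 1# * - 1# ≡ 1#
    [-1][-1]≡1 = trans (-1*x≈-x (- 1#)) (-‿involutive 1#)

  a-1<a : ∀ a → a - 1# < a
  a-1<a a = subst (a - 1# <_) (+-identityʳ a) (+-monoʳ-< a -1<0)
    where
    -1<0 : - 1# < 0#
    -1<0 = 0<-⇒<0 (subst (0# <_) (sym (-‿involutive 1#)) 0<1)

  pos⇒inverse-pos : ∀ {a b} → 0# < a → a * b ≡ 1# → 0# < b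
  pos⇒inverse-pos {a} {b} 0<a ab≡1 with compare 0# b
  ... | tri< 0<b _ _ = 0<b
  ... | tri≈ _ 0≡b _ = ⊥-elim (0≢1 (trans (sym (zeroʳ a)) (trans (cong (a *_) 0≡b) ab≡1)))
  ... | tri> _ _ b<0 =
    ⊥-elim (asym 0<1 (0<-⇒<0 (subst (0# <_) a[-b]≡-1 (*-pos a (- b) 0<a (<0⇒0<- b<0)))))
    where
    a[-b]≡-1 : a * - b ≡ - 1#
    a[-b]≡-1 = trans (sym (-‿distribʳ-* a b)) (cong -_ ab≡1)

  pos⇒a*a⁻¹≡1 : ∀ {a} → 0# < a → a * a ⁻¹ ≡ 1#
  pos⇒a*a⁻¹≡1 {a} 0<a = ⁻¹-inverse a (λ a≡0 → irrefl (sym a≡0) 0<a)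

  *-monoˡ-< : ∀ {c a b} → 0# < c → a < b → c * a < c * b
  *-monoˡ-< {c} {a} {b} 0<c a<b =
    subst₂ _<_ (+-identityˡ (c * a)) (//-rightDividesˡ (c * a) (c * b)) (+-monoˡ-< (c * a) 0<cb-ca)
    where
    0<cb-ca : 0# < c * b - c * a
    0<cb-ca = subst (0# <_) (x[y-z]≈xy-xz c b a)
                (*-pos c (b - a) 0<c (subst (_< b - a) (-‿inverseʳ a) (+-monoˡ-< (- a) a<b)))

  inverse-antimono-<-pos : ∀ {a b a⁻ b⁻} → 0# < a → a < b →
                           a⁻ * a ≡ 1# → b⁻ * b ≡ 1# → b⁻ < a⁻
  inverse-antimono-<-pos {a} {b} {a⁻} {b⁻} 0<a a<b a⁻a≡1 b⁻b≡1 =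
    subst₂ _<_ a⁻b⁻a≡b⁻ a⁻b⁻b≡a⁻ (*-monoˡ-< 0<a⁻b⁻ a<b)
    where
    0<a⁻b⁻ : 0# < a⁻ * b⁻
    0<a⁻b⁻ = *-pos a⁻ b⁻ (pos⇒inverse-pos 0<a (trans (*-comm a a⁻) a⁻a≡1))
                          (pos⇒inverse-pos (<-trans 0<a a<b) (trans (*-comm b b⁻) b⁻b≡1))
    a⁻b⁻a≡b⁻ : a⁻ * b⁻ * a ≡ b⁻
    a⁻b⁻a≡b⁻ = begin
      a⁻ * b⁻ * a   ≡⟨ cong (_* a) (*-comm a⁻ b⁻) ⟩
      b⁻ * a⁻ * a   ≡⟨ *-assoc b⁻ a⁻ a ⟩
      b⁻ * (a⁻ * a) ≡⟨ cong (b⁻ *_) a⁻a≡1 ⟩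
      b⁻ * 1#       ≡⟨ *-identityʳ b⁻ ⟩
      b⁻            ∎
    a⁻b⁻b≡a⁻ : a⁻ * b⁻ * b ≡ a⁻
    a⁻b⁻b≡a⁻ = trans (*-assoc a⁻ b⁻ b) (trans (cong (a⁻ *_) b⁻b≡1) (*-identityʳ a⁻))

module HFieldProperties {ℓ : Level} {F : OrderedField ℓ} (H : HFieldCompInvOverℝ F) where
  open OF F
  open HFieldCompInvOverℝ H
  open OrderedFieldProperties F
  open ≡-Reasoning

  Const-0 : Const ∂ 0#
  Const-0 = x+x≈x⇒x≈0 (∂ 0#) (trans (sym (∂-+ 0# 0#)) (cong ∂ (+-identityʳ 0#)))

  Const-1 : Const ∂ 1#
  Const-1 = x+x≈x⇒x≈0 (∂ 1#) (sym (begin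
    ∂ 1#                  ≡⟨ cong ∂ (sym (*-identityʳ 1#)) ⟩
    ∂ (1# * 1#)           ≡⟨ ∂-* 1# 1# ⟩
    ∂ 1# * 1# + 1# * ∂ 1# ≡⟨ cong (∂ 1# * 1# +_) (*-comm 1# (∂ 1#)) ⟩
    ∂ 1# * 1# + ∂ 1# * 1# ≡⟨ cong (λ t → t + t) (*-identityʳ (∂ 1#)) ⟩
    ∂ 1# + ∂ 1#           ∎))

  Const-+ : ∀ {a b} → Const ∂ a → Const ∂ b → Const ∂ (a + b)
  Const-+ {a} {b} a∈C b∈C = begin
    ∂ (a + b)   ≡⟨ ∂-+ a b ⟩
    ∂ a + ∂ b   ≡⟨ cong₂ _+_ a∈C b∈C ⟩
    0# + 0#     ≡⟨ +-identityʳ 0# ⟩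
    0#          ∎

  Const-neg : ∀ {a} → Const ∂ a → Const ∂ (- a)
  Const-neg {a} a∈C = begin
    ∂ (- a)       ≡⟨ sym (+-identityʳ (∂ (- a))) ⟩
    ∂ (- a) + 0#  ≡⟨ cong (∂ (- a) +_) (sym a∈C) ⟩
    ∂ (- a) + ∂ a ≡⟨ sym (∂-+ (- a) a) ⟩
    ∂ (- a + a)   ≡⟨ cong ∂ (trans (+-comm (- a) a) (-‿inverseʳ a)) ⟩
    ∂ 0#          ≡⟨ Const-0 ⟩
    0#            ∎

  C∩O : K → Set ℓ
  C∩O s = Const ∂ s × O s

  -- C ∩ O is closed under s ↦ s + 1, so a supremum u in C would have the smaller upper bound u - 1.
  C∩O-unbounded : ∀ {c} → Const ∂ c → ¬ (∀ s → C∩O s → s ≤ c)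
  C∩O-unbounded c∈C c-bounds
    with C-complete C∩O (λ _ → proj₁) (0# , Const-0 , O-0) (_ , c∈C , c-bounds)
  ... | u , u∈C , u-bounds , u-least =
    irrefl refl (<-≤-trans (a-1<a u) (u-least (u - 1#) u-1∈C u-1-bounds))
    where
    u-1∈C : Const ∂ (u - 1#)
    u-1∈C = Const-+ u∈C (Const-neg Const-1)
    u-1-bounds : ∀ s → C∩O s → s ≤ u - 1#
    u-1-bounds s (s∈C , s∈O) =
      subst (_≤ u - 1#) (//-rightDividesʳ 1# s)
        (+-monoˡ-≤ (- 1#) (u-bounds (s + 1#) (Const-+ s∈C Const-1 , O-+ s 1# s∈O O-1)))

  pos-Const⇒¬¬O : ∀ {c} → Const ∂ c → 0# < c → ¬ ¬ O c
  pos-Const⇒¬¬O {c} c∈C 0<c c∉O = C∩O-unbounded c∈C c-bounds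
    where
    c-bounds : ∀ s → C∩O s → s ≤ c
    c-bounds s (_ , s∈O) = ≮⇒≥ λ c<s → c∉O (O-convex 0# c s O-0 s∈O (inj₁ 0<c) (inj₁ c<s))

  pos-∉O⇒AboveC : ∀ {a} → 0# < a → ¬ O a → AboveC ∂ a
  pos-∉O⇒AboveC {a} 0<a a∉O c c∈C = ≰⇒> λ a≤c →
    pos-Const⇒¬¬O c∈C (<-≤-trans 0<a a≤c)
      (λ c∈O → a∉O (O-convex 0# a c O-0 c∈O (inj₁ 0<a) a≤c))

  small-pos⇒⁻¹-AboveC : ∀ {ε} → small O ε → 0# < ε → AboveC ∂ (ε ⁻¹)
  small-pos⇒⁻¹-AboveC {ε} (_ , ε-nonunit) 0<ε =
    pos-∉O⇒AboveC (pos⇒inverse-pos 0<ε εε⁻¹≡1)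
      (λ ε⁻¹∈O → ε-nonunit (ε ⁻¹) ε⁻¹∈O εε⁻¹≡1)
    where
    εε⁻¹≡1 : ε * ε ⁻¹ ≡ 1#
    εε⁻¹≡1 = pos⇒a*a⁻¹≡1 0<ε

  x+C<a⇒C<a-x : ∀ {a} → (∀ r → Const ∂ r → x + r < a) → AboveC ∂ (a - x)
  x+C<a⇒C<a-x {a} x+C<a c c∈C = subst (_< a - x) (xyx⁻¹≈y x c) (+-monoˡ-< (- x) (x+C<a c c∈C))

  C<a⇒a<a∘b : ∀ {a b} → AboveC ∂ a → AboveC ∂ b → x < b → a < a ∘ b
  C<a⇒a<a∘b {a} {b} a>C b>C x<b =
    subst (_< a ∘ b) (HFC4-r a) (HFC3-mono a x b a>C x-above b>C x<b)

  small-pos⇒ε∘b<ε : ∀ {ε b} → small O ε → 0# < ε → AboveC ∂ b → x < b → ε ∘ b < ε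
  small-pos⇒ε∘b<ε {ε} {b} ε∈o 0<ε b>C x<b =
    inverse-antimono-<-pos (ε⁻¹>C 0# Const-0) (C<a⇒a<a∘b ε⁻¹>C b>C x<b)
      (pos⇒a*a⁻¹≡1 0<ε) [ε∘b][ε⁻¹∘b]≡1
    where
    ε⁻¹>C : AboveC ∂ (ε ⁻¹)
    ε⁻¹>C = small-pos⇒⁻¹-AboveC ε∈o 0<ε
    [ε∘b][ε⁻¹∘b]≡1 : ε ∘ b * (ε ⁻¹) ∘ b ≡ 1#
    [ε∘b][ε⁻¹∘b]≡1 = begin
      ε ∘ b * (ε ⁻¹) ∘ b ≡⟨ sym (HFC1-* ε (ε ⁻¹) b b>C) ⟩
      (ε * ε ⁻¹) ∘ b     ≡⟨ cong (_∘ b) (pos⇒a*a⁻¹≡1 0<ε) ⟩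
      1# ∘ b             ≡⟨ HFC1-1 b b>C ⟩
      1#                 ∎

lemma4p19 : {ℓ : Level} (F : OrderedField ℓ) (H : HFieldCompInvOverℝ F) →
  let open OF F
      open HFieldCompInvOverℝ H
  in (f g : K) → AboveC ∂ f → AboveC ∂ g → x < f → x < g →
     (∀ r → Const ∂ r → x + r < f) →
     Σ K (λ ε → small O ε × (0# < ε) × (g ≡ x + 1# + ε)) →
     g ∘ f < f ∘ g
lemma4p19 F H f g f>C g>C x<f x<g x+C<f (ε , ε∈o , 0<ε , g≡x+1+ε) = begin-strict
  g ∘ f                      ≡⟨ cong (_∘ f) g≡x+1+ε ⟩
  (x + 1# + ε) ∘ f           ≡⟨ HFC1-+ (x + 1#) ε f f>C ⟩
  (x + 1#) ∘ f + ε ∘ f       ≡⟨ cong (_+ ε ∘ f) (HFC1-+ x 1# f f>C) ⟩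
  x ∘ f + 1# ∘ f + ε ∘ f     ≡⟨ cong (λ t → t + 1# ∘ f + ε ∘ f) (HFC4-l f f>C) ⟩
  f + 1# ∘ f + ε ∘ f         ≡⟨ cong (λ t → f + t + ε ∘ f) (HFC1-1 f f>C) ⟩
  f + 1# + ε ∘ f             <⟨ +-monoʳ-< (f + 1#) (small-pos⇒ε∘b<ε ε∈o 0<ε f>C x<f) ⟩
  f + 1# + ε                 ≡⟨ cong (λ t → t + 1# + ε) (sym (//-rightDividesˡ x f)) ⟩
  f - x + x + 1# + ε         ≡⟨ cong (_+ ε) (+-assoc (f - x) x 1#) ⟩
  f - x + (x + 1#) + ε       ≡⟨ +-assoc (f - x) (x + 1#) ε ⟩
  f - x + (x + 1# + ε)       ≡⟨ cong (f - x +_) (sym g≡x+1+ε) ⟩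
  f - x + g                  <⟨ +-monoˡ-< g (C<a⇒a<a∘b (x+C<a⇒C<a-x x+C<f) g>C x<g) ⟩
  (f - x) ∘ g + g            ≡⟨ cong ((f - x) ∘ g +_) (sym (HFC4-l g g>C)) ⟩
  (f - x) ∘ g + x ∘ g        ≡⟨ sym (HFC1-+ (f - x) x g g>C) ⟩
  (f - x + x) ∘ g            ≡⟨ cong (_∘ g) (//-rightDividesˡ x f) ⟩
  f ∘ g                      ∎
  where
  open OF F
  open HFieldCompInvOverℝ H
  open OrderedFieldProperties F
  open HFieldProperties H
  open StrictReasoning <-strictPartialOrder
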